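{- Let $G$ be a finite simple graph with maximum degree $\Delta$ and let $k\ge 1$ be an integer such that $\iota_k(G)>0$. Then $$\frac{\iota'_k(G)}{\iota_k(G)}\le \Delta-2\sqrt{\Delta}+2 .$$
   Context: For $S\subseteq V(G)$, $N_G[S]$ is the closed neighborhood of $S$ (the vertices of $S$ together with all their neighbors). $K_k$ is the complete graph on $k$ vertices. A set $S\subseteq V(G)$ is $K_k$-isolating if $G-N_G[S]$ contains no subgraph isomorphic to $K_k$; $\iota_k(G)$ is the minimum cardinality of a $K_k$-isolating set. A set is independent $K_k$-isolating if it is $K_k$-isolating and induces no edge; $\iota'_k(G)$ is the minimum cardinality of an independent $K_k$-isolating set. -}

module Defs where

open import Data.Nat using (ℕ; _≤_; _⊔_)
open import Data.Bool using (Bool; true; false)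
open import Data.Fin using (Fin)
open import Data.Fin.Subset using (Subset; _∈_; ∣_∣)
open import Data.Vec using (tabulate)
open import Data.List using (foldr; map; allFin)
open import Data.Product using (Σ; ∃; _×_)
open import Data.Sum using (_⊎_)
open import Relation.Binary.PropositionalEquality using (_≡_; _≢_)
open import Relation.Nullary using (¬_)
open import Function.Definitions using (Injective)

record Graph (n : ℕ) : Set where
  field
    adj    : Fin n → Fin n → Bool
    sym    : ∀ u v → adj u v ≡ adj v u
    irrefl : ∀ v → adj v v ≡ false
open Graph public

Adj : ∀ {n} → Graph n → Fin n → Fin n → Set
Adj G u v = adj G u v ≡ true

nbhd : ∀ {n} → Graph n → Fin n → Subset n
nbhd G v = tabulate (λ w → adj G v w)

degree : ∀ {n} → Graph n → Fin n → ℕ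
degree G v = ∣ nbhd G v ∣

-- maximum degree Δ(G) (0 for the empty graph)
maxDegree : ∀ {n} → Graph n → ℕ
maxDegree {n} G = foldr _⊔_ 0 (map (degree G) (allFin n))

InClosedNbhd : ∀ {n} → Graph n → Subset n → Fin n → Set
InClosedNbhd G S w = w ∈ S ⊎ ∃ (λ v → v ∈ S × Adj G v w)

-- G - N_G[S] contains a subgraph isomorphic to K_k
HasKkOutside : ∀ {n} → Graph n → ℕ → Subset n → Set
HasKkOutside {n} G k S =
  Σ (Fin k → Fin n) λ f →
    Injective _≡_ _≡_ f
    × (∀ i → ¬ InClosedNbhd G S (f i))
    × (∀ i j → i ≢ j → Adj G (f i) (f j))

IsKkIsolating : ∀ {n} → Graph n → ℕ → Subset n → Set
IsKkIsolating G k S = ¬ HasKkOutside G k S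

Independent : ∀ {n} → Graph n → Subset n → Set
Independent G S = ∀ u v → u ∈ S → v ∈ S → adj G u v ≡ false

IsIndepKkIsolating : ∀ {n} → Graph n → ℕ → Subset n → Set
IsIndepKkIsolating G k S = IsKkIsolating G k S × Independent G S

IsMinCard : ∀ {n} → (Subset n → Set) → ℕ → Set
IsMinCard {n} P m = (∃ λ S → P S × ∣ S ∣ ≡ m) × (∀ S → P S → m ≤ ∣ S ∣)

IsIota : ∀ {n} → Graph n → ℕ → ℕ → Set
IsIota G k m = IsMinCard (IsKkIsolating G k) m

IsIotaIndep : ∀ {n} → Graph n → ℕ → ℕ → Set
IsIotaIndep G k m = IsMinCard (IsIndepKkIsolating G k) m

{-# OPTIONS --safe #-}
-- Start from a minimum K_k-isolating set S and build an independent set T with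
-- N[S] ⊆ N[T], so that T is K_k-isolating as well. Greedily pick v among the
-- unprocessed vertices R ⊆ S with the fewest, say d, neighbours in R; v goes
-- into T, and v and its d neighbours in R leave R. Each such neighbour b has at
-- least d neighbours in R by minimality, hence at most Δ − d outside R, and
-- these are queued to be dominated later, at the price of one vertex of T each.
-- A group of 1 + d vertices of S therefore costs at most
-- 1 + d(Δ − d) = (1 + d)(Δ + 2) − ((1 + d)² + Δ), and the saving (1 + d)² + Δ is
-- at least 2(1 + d)√Δ by AM–GM. Summing over the groups,
-- ι' ≤ |T| ≤ |S|(Δ + 2) − X with X ≥ 2|S|√Δ.
module Submission where

open import Defs hiding (sym)
open import Data.Nat using (ℕ; suc; _+_; _*_; _∸_; _^_; _≤_; _<_; _⊔_; z≤n; s≤s)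
open import Data.Nat.Properties
open import Data.Nat.Induction using (<-wellFounded)
open import Data.Nat.Tactic.RingSolver using (solve-∀)
open import Induction.WellFounded using (Acc; acc)
open import Data.Bool using (true; false)
open import Data.Bool.Properties using (¬-not) renaming (_≟_ to _≟ᵇ_)
open import Data.Fin using (Fin; zero; suc)
open import Data.Fin.Properties using (any?) renaming (_≟_ to _≟ᶠ_)
open import Data.Fin.Subset
  using (Subset; _∈_; _∉_; _⊆_; _∪_; _∩_; _─_; _-_; ⁅_⁆; ⊥; ∣_∣; Nonempty)
open import Data.Fin.Subset.Properties
  using ( _∈?_; nonempty?; Empty-unique; ∉⊥; ∣⊥∣≡0; ∣⁅x⁆∣≡1; x∈⁅x⁆; x∈⁅y⁆⇒x≡y
        ; ⊆-refl; ⊆-trans; p⊆p∪q; q⊆p∪q; x∈p∪q⁻; x∈p∩q⁺; p∩q⊆p; ∣p∩q∣≤∣q∣; ∩-comm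
        ; p─⊥≡p; p─q⊆p; x∈p∧x∉q⇒x∈p─q; x∈p∧x≢y⇒x∈p-y )
open import Data.Vec using ([]; _∷_; here; there)
open import Data.Vec.Properties using (lookup∘tabulate; []=⇒lookup; lookup⇒[]=)
open import Data.List using (List; allFin; filter)
open import Data.List.Properties using (foldr-forcesᵇ)
import Data.List.Relation.Unary.All as All
open import Data.List.Relation.Unary.All.Properties using (all-filter; map⁻)
open import Data.List.Membership.Propositional.Properties using (∈-allFin; ∈-filter⁺)
open import Data.List.Extrema.Nat using (argmin; argmin-all; f[argmin]≤f[xs])
open import Data.Product using (∃; ∃₂; _×_; _,_)
open import Data.Sum using (_⊎_; inj₁; inj₂)
import Data.Sum as Sum
open import Data.Empty using (⊥-elim)
open import Function using (_∘_)
open import Relation.Binary.PropositionalEquality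
  using (_≡_; refl; sym; trans; cong; subst; module ≡-Reasoning)
open import Relation.Nullary using (Dec; yes; no)
open import Relation.Nullary.Decidable using (_×-dec_; _⊎-dec_)

private
  variable
    n : ℕ
    p q : Subset n
    x : Fin n

∣p∪q∣≤∣p∣+∣q∣ : (p q : Subset n) → ∣ p ∪ q ∣ ≤ ∣ p ∣ + ∣ q ∣
∣p∪q∣≤∣p∣+∣q∣ []          []          = z≤n
∣p∪q∣≤∣p∣+∣q∣ (true ∷ p)  (true ∷ q)  =
  s≤s (≤-trans (∣p∪q∣≤∣p∣+∣q∣ p q) (+-monoʳ-≤ ∣ p ∣ (n≤1+n ∣ q ∣)))
∣p∪q∣≤∣p∣+∣q∣ (true ∷ p)  (false ∷ q) = s≤s (∣p∪q∣≤∣p∣+∣q∣ p q)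
∣p∪q∣≤∣p∣+∣q∣ (false ∷ p) (true ∷ q)  =
  subst (suc ∣ p ∪ q ∣ ≤_) (sym (+-suc ∣ p ∣ ∣ q ∣)) (s≤s (∣p∪q∣≤∣p∣+∣q∣ p q))
∣p∪q∣≤∣p∣+∣q∣ (false ∷ p) (false ∷ q) = ∣p∪q∣≤∣p∣+∣q∣ p q

∣p∪⁅x⁆∣≤1+∣p∣ : (p : Subset n) (x : Fin n) → ∣ p ∪ ⁅ x ⁆ ∣ ≤ suc ∣ p ∣
∣p∪⁅x⁆∣≤1+∣p∣ p x = begin
  ∣ p ∪ ⁅ x ⁆ ∣       ≤⟨ ∣p∪q∣≤∣p∣+∣q∣ p ⁅ x ⁆ ⟩
  ∣ p ∣ + ∣ ⁅ x ⁆ ∣   ≡⟨ cong (∣ p ∣ +_) (∣⁅x⁆∣≡1 x) ⟩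
  ∣ p ∣ + 1           ≡⟨ +-comm ∣ p ∣ 1 ⟩
  suc ∣ p ∣           ∎
  where open ≤-Reasoning

∣p∣≡∣p∩q∣+∣p─q∣ : (p q : Subset n) → ∣ p ∣ ≡ ∣ p ∩ q ∣ + ∣ p ─ q ∣
∣p∣≡∣p∩q∣+∣p─q∣ []          []          = refl
∣p∣≡∣p∩q∣+∣p─q∣ (true ∷ p)  (true ∷ q)  = cong suc (∣p∣≡∣p∩q∣+∣p─q∣ p q)
∣p∣≡∣p∩q∣+∣p─q∣ (true ∷ p)  (false ∷ q) =
  trans (cong suc (∣p∣≡∣p∩q∣+∣p─q∣ p q)) (sym (+-suc ∣ p ∩ q ∣ ∣ p ─ q ∣))
∣p∣≡∣p∩q∣+∣p─q∣ (false ∷ p) (true ∷ q)  = ∣p∣≡∣p∩q∣+∣p─q∣ p q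
∣p∣≡∣p∩q∣+∣p─q∣ (false ∷ p) (false ∷ q) = ∣p∣≡∣p∩q∣+∣p─q∣ p q

x∈p⇒∣p∣≡1+∣p-x∣ : x ∈ p → ∣ p ∣ ≡ suc ∣ p - x ∣
x∈p⇒∣p∣≡1+∣p-x∣ {p = true ∷ p}  here        = cong (suc ∘ ∣_∣) (sym (p─⊥≡p p))
x∈p⇒∣p∣≡1+∣p-x∣ {p = true ∷ p}  (there x∈p) = cong suc (x∈p⇒∣p∣≡1+∣p-x∣ x∈p)
x∈p⇒∣p∣≡1+∣p-x∣ {p = false ∷ p} (there x∈p) = x∈p⇒∣p∣≡1+∣p-x∣ x∈p

x∈p─q⇒x∉q : x ∈ p ─ q → x ∉ q
x∈p─q⇒x∉q {p = true ∷ _} {q = false ∷ _} here          ()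
x∈p─q⇒x∉q {p = _ ∷ _}    {q = _ ∷ _}     (there x∈p─q) (there x∈q) = x∈p─q⇒x∉q x∈p─q x∈q

unionOver : ∀ {m} → Subset m → (Fin m → Subset n) → Subset n
unionOver []          f = ⊥
unionOver (true ∷ B)  f = f zero ∪ unionOver B (f ∘ suc)
unionOver (false ∷ B) f = unionOver B (f ∘ suc)

∈-unionOver⁺ : ∀ {m} {B : Subset m} {b} (f : Fin m → Subset n) →
               b ∈ B → x ∈ f b → x ∈ unionOver B f
∈-unionOver⁺ {B = true ∷ B}  f here        x∈fb = p⊆p∪q (unionOver B (f ∘ suc)) x∈fb
∈-unionOver⁺ {B = true ∷ B}  f (there b∈B) x∈fb =
  q⊆p∪q (f zero) (unionOver B (f ∘ suc)) (∈-unionOver⁺ (f ∘ suc) b∈B x∈fb)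
∈-unionOver⁺ {B = false ∷ B} f (there b∈B) x∈fb = ∈-unionOver⁺ (f ∘ suc) b∈B x∈fb

∣unionOver∣≤∣B∣*c : ∀ {m} (B : Subset m) (f : Fin m → Subset n) {c} →
                    (∀ {b} → b ∈ B → ∣ f b ∣ ≤ c) → ∣ unionOver B f ∣ ≤ ∣ B ∣ * c
∣unionOver∣≤∣B∣*c {n = n} [] f ∣fb∣≤c = ≤-reflexive (∣⊥∣≡0 n)
∣unionOver∣≤∣B∣*c (true ∷ B)  f ∣fb∣≤c =
  ≤-trans (∣p∪q∣≤∣p∣+∣q∣ (f zero) (unionOver B (f ∘ suc)))
          (+-mono-≤ (∣fb∣≤c here) (∣unionOver∣≤∣B∣*c B (f ∘ suc) (∣fb∣≤c ∘ there)))
∣unionOver∣≤∣B∣*c (false ∷ B) f ∣fb∣≤c = ∣unionOver∣≤∣B∣*c B (f ∘ suc) (∣fb∣≤c ∘ there)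

minimiser : (f : Fin n → ℕ) (R : Subset n) → Nonempty R →
            ∃ λ v → v ∈ R × (∀ {u} → u ∈ R → f v ≤ f u)
minimiser f R (x , x∈R) =
  argmin f x candidates ,
  argmin-all f {P = _∈ R} x∈R (all-filter (_∈? R) (allFin _)) ,
  λ u∈R → All.lookup (f[argmin]≤f[xs] {f = f} x candidates)
                     (∈-filter⁺ (_∈? R) (∈-allFin _) u∈R)
  where
  candidates : List (Fin _)
  candidates = filter (_∈? R) (allFin _)

m*m≤n*n⇒m≤n : ∀ {m n} → m * m ≤ n * n → m ≤ n
m*m≤n*n⇒m≤n m*m≤n*n = ≮⇒≥ (λ n<m → <⇒≱ (*-mono-< n<m n<m) m*m≤n*n)

4ab≤[a+b]² : ∀ a b → 4 * a * b ≤ (a + b) * (a + b)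
4ab≤[a+b]² a b with ≤-total a b
... | inj₁ a≤b with m≤n⇒∃[o]m+o≡n a≤b
...   | r , refl = ≤-trans (m≤m+n _ (r * r)) (≤-reflexive (square a r))
  where
  square : ∀ a r → 4 * a * (a + r) + r * r ≡ (a + (a + r)) * (a + (a + r))
  square = solve-∀
4ab≤[a+b]² a b | inj₂ b≤a with m≤n⇒∃[o]m+o≡n b≤a
...   | r , refl = ≤-trans (m≤m+n _ (r * r)) (≤-reflexive (square b r))
  where
  square : ∀ b r → 4 * (b + r) * b + r * r ≡ ((b + r) + b) * ((b + r) + b)
  square = solve-∀

-- RootBound Δ m X says 2 m √Δ ≤ X, squared so as to stay in ℕ.
RootBound : ℕ → ℕ → ℕ → Set
RootBound Δ m X = 4 * (m * m) * Δ ≤ X * X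

RootBound-square : ∀ Δ m → RootBound Δ m (m * m + Δ)
RootBound-square Δ m = 4ab≤[a+b]² (m * m) Δ

RootBound-mono : ∀ {Δ m X Y} → X ≤ Y → RootBound Δ m X → RootBound Δ m Y
RootBound-mono X≤Y mX = ≤-trans mX (*-mono-≤ X≤Y X≤Y)

RootBound-+ : ∀ {Δ m l X Y} → RootBound Δ m X → RootBound Δ l Y →
              RootBound Δ (m + l) (X + Y)
RootBound-+ {Δ} {m} {l} {X} {Y} mX lY = begin
  4 * ((m + l) * (m + l)) * Δ
    ≡⟨ expand Δ m l ⟩
  4 * (m * m) * Δ + 4 * (l * l) * Δ + 2 * (4 * m * l * Δ)
    ≤⟨ +-mono-≤ (+-mono-≤ mX lY) (*-monoʳ-≤ 2 cross) ⟩
  X * X + Y * Y + 2 * (X * Y)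
    ≡⟨ expand′ X Y ⟩
  (X + Y) * (X + Y)
    ∎
  where
  open ≤-Reasoning
  expand : ∀ Δ m l → 4 * ((m + l) * (m + l)) * Δ ≡
                     4 * (m * m) * Δ + 4 * (l * l) * Δ + 2 * (4 * m * l * Δ)
  expand = solve-∀
  expand′ : ∀ X Y → X * X + Y * Y + 2 * (X * Y) ≡ (X + Y) * (X + Y)
  expand′ = solve-∀
  cross-squared : ∀ Δ m l → (4 * m * l * Δ) * (4 * m * l * Δ) ≡
                            (4 * (m * m) * Δ) * (4 * (l * l) * Δ)
  cross-squared = solve-∀
  square-product : ∀ X Y → (X * X) * (Y * Y) ≡ (X * Y) * (X * Y)
  square-product = solve-∀
  cross : 4 * m * l * Δ ≤ X * Y
  cross = m*m≤n*n⇒m≤n (begin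
    (4 * m * l * Δ) * (4 * m * l * Δ)        ≡⟨ cross-squared Δ m l ⟩
    (4 * (m * m) * Δ) * (4 * (l * l) * Δ)    ≤⟨ *-mono-≤ mX lY ⟩
    (X * X) * (Y * Y)                        ≡⟨ square-product X Y ⟩
    (X * Y) * (X * Y)                        ∎)

group-cost : ∀ {d Δ} → d ≤ Δ → 1 + d * (Δ ∸ d) + (suc d * suc d + Δ) ≡ suc d * (Δ + 2)
group-cost {d} d≤Δ with m≤n⇒∃[o]m+o≡n d≤Δ
... | e , refl rewrite m+n∸m≡n d e = identity d e
  where
  identity : ∀ d e → 1 + d * e + (suc d * suc d + (d + e)) ≡ suc d * (d + e + 2)
  identity = solve-∀

module _ {n} (G : Graph n) where

  private
    Δ : ℕ
    Δ = maxDegree G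

  ∈-nbhd⁺ : ∀ {v w} → Adj G v w → w ∈ nbhd G v
  ∈-nbhd⁺ {v} {w} vw = lookup⇒[]= w (nbhd G v) (trans (lookup∘tabulate (adj G v) w) vw)

  ∈-nbhd⁻ : ∀ {v w} → w ∈ nbhd G v → Adj G v w
  ∈-nbhd⁻ {v} {w} w∈N = trans (sym (lookup∘tabulate (adj G v) w)) ([]=⇒lookup w∈N)

  ∉-nbhd⁻ : ∀ {v w} → w ∉ nbhd G v → adj G v w ≡ false
  ∉-nbhd⁻ w∉N = ¬-not (w∉N ∘ ∈-nbhd⁺)

  v∉nbhd[v] : ∀ {v} → v ∉ nbhd G v
  v∉nbhd[v] {v} v∈N with trans (sym (irrefl G v)) (∈-nbhd⁻ v∈N)
  ... | ()

  degree≤maxDegree : ∀ v → degree G v ≤ Δ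
  degree≤maxDegree v =
    All.lookup (map⁻ (foldr-forcesᵇ ⊔-bounded 0 _ ≤-refl)) (∈-allFin v)
    where
    ⊔-bounded : ∀ a b → a ⊔ b ≤ Δ → a ≤ Δ × b ≤ Δ
    ⊔-bounded a b a⊔b≤Δ = m⊔n≤o⇒m≤o a b a⊔b≤Δ , m⊔n≤o⇒n≤o a b a⊔b≤Δ

  closedNbhd-mono : p ⊆ q → InClosedNbhd G p x → InClosedNbhd G q x
  closedNbhd-mono p⊆q (inj₁ x∈p)             = inj₁ (p⊆q x∈p)
  closedNbhd-mono p⊆q (inj₂ (v , v∈p , vx)) = inj₂ (v , p⊆q v∈p , vx)

  closedNbhd? : ∀ p x → Dec (InClosedNbhd G p x)
  closedNbhd? p x = (x ∈? p) ⊎-dec any? (λ v → (v ∈? p) ×-dec (adj G v x ≟ᵇ true))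

  isolating-mono : ∀ {k S T} → (∀ {w} → InClosedNbhd G S w → InClosedNbhd G T w) →
                   IsKkIsolating G k S → IsKkIsolating G k T
  isolating-mono N[S]⊆N[T] S-isolating (f , f-injective , f-outside , f-clique) =
    S-isolating (f , f-injective , (λ i → f-outside i ∘ N[S]⊆N[T]) , f-clique)

  independent-∪⁅⁆ : ∀ {A w} → Independent G A → (∀ {a} → a ∈ A → adj G a w ≡ false) →
                    Independent G (A ∪ ⁅ w ⁆)
  independent-∪⁅⁆ {A} {w} A-independent A≁w u v u∈ v∈
    with x∈p∪q⁻ A ⁅ w ⁆ u∈ | x∈p∪q⁻ A ⁅ w ⁆ v∈
  ... | inj₁ u∈A | inj₁ v∈A = A-independent u v u∈A v∈A
  ... | inj₁ u∈A | inj₂ v∈w rewrite x∈⁅y⁆⇒x≡y w v∈w = A≁w u∈A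
  ... | inj₂ u∈w | inj₁ v∈A rewrite x∈⁅y⁆⇒x≡y w u∈w = trans (Graph.sym G w v) (A≁w v∈A)
  ... | inj₂ u∈w | inj₂ v∈w rewrite x∈⁅y⁆⇒x≡y w u∈w | x∈⁅y⁆⇒x≡y w v∈w = irrefl G w

  absorb : ∀ {A} → Independent G A → ∀ w →
           ∃ λ A' → Independent G A' × A ⊆ A' × InClosedNbhd G A' w × ∣ A' ∣ ≤ suc ∣ A ∣
  absorb {A} A-independent w with closedNbhd? A w
  ... | yes w∈N[A] = A , A-independent , ⊆-refl , w∈N[A] , n≤1+n ∣ A ∣
  ... | no w∉N[A]  =
    A ∪ ⁅ w ⁆ ,
    independent-∪⁅⁆ A-independent (λ a∈A → ¬-not (λ aw → w∉N[A] (inj₂ (_ , a∈A , aw)))) ,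
    p⊆p∪q ⁅ w ⁆ ,
    inj₁ (q⊆p∪q A ⁅ w ⁆ (x∈⁅x⁆ w)) ,
    ∣p∪⁅x⁆∣≤1+∣p∣ A w

  record IndependentDominator (A U : Subset n) : Set where
    field
      T             : Subset n
      T-independent : Independent G T
      A⊆T           : A ⊆ T
      dominates-U   : ∀ {w} → w ∈ U → InClosedNbhd G T w
      ∣T∣≤∣A∣+∣U∣   : ∣ T ∣ ≤ ∣ A ∣ + ∣ U ∣

  independentDominator : ∀ {A} → Independent G A → (U : Subset n) → Acc _<_ ∣ U ∣ →
                         IndependentDominator A U
  independentDominator {A} A-independent U (acc smaller) with nonempty? U
  ... | no U-empty = record
    { T             = A
    ; T-independent = A-independent
    ; A⊆T           = ⊆-refl
    ; dominates-U   = λ w∈U → ⊥-elim (U-empty (_ , w∈U))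
    ; ∣T∣≤∣A∣+∣U∣   = m≤m+n ∣ A ∣ ∣ U ∣
    }
  ... | yes (w , w∈U) with absorb A-independent w
  ... | A' , A'-independent , A⊆A' , w∈N[A'] , ∣A'∣≤1+∣A∣ = record
    { T             = T
    ; T-independent = T-independent
    ; A⊆T           = ⊆-trans A⊆A' A⊆T
    ; dominates-U   = dominates-U′
    ; ∣T∣≤∣A∣+∣U∣   = ∣T∣≤∣A∣+∣U∣′
    }
    where
    ∣U∣≡1+∣U-w∣ : ∣ U ∣ ≡ suc ∣ U - w ∣
    ∣U∣≡1+∣U-w∣ = x∈p⇒∣p∣≡1+∣p-x∣ w∈U

    open IndependentDominator
      (independentDominator A'-independent (U - w) (smaller (≤-reflexive (sym ∣U∣≡1+∣U-w∣))))

    dominates-U′ : ∀ {u} → u ∈ U → InClosedNbhd G T u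
    dominates-U′ {u} u∈U with u ≟ᶠ w
    ... | yes refl = closedNbhd-mono A⊆T w∈N[A']
    ... | no u≢w   = dominates-U (x∈p∧x≢y⇒x∈p-y u∈U u≢w)

    ∣T∣≤∣A∣+∣U∣′ : ∣ T ∣ ≤ ∣ A ∣ + ∣ U ∣
    ∣T∣≤∣A∣+∣U∣′ = begin
      ∣ T ∣                  ≤⟨ ∣T∣≤∣A∣+∣U∣ ⟩
      ∣ A' ∣ + ∣ U - w ∣     ≤⟨ +-monoˡ-≤ ∣ U - w ∣ ∣A'∣≤1+∣A∣ ⟩
      suc ∣ A ∣ + ∣ U - w ∣  ≡⟨ sym (+-suc ∣ A ∣ ∣ U - w ∣) ⟩
      ∣ A ∣ + suc ∣ U - w ∣  ≡⟨ cong (∣ A ∣ +_) (sym ∣U∣≡1+∣U-w∣) ⟩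
      ∣ A ∣ + ∣ U ∣          ∎
      where open ≤-Reasoning

  record GreedyCover (R : Subset n) : Set where
    field
      A U           : Subset n
      slack         : ℕ
      A⊆R           : A ⊆ R
      A-independent : Independent G A
      covers        : ∀ {w} → InClosedNbhd G R w → InClosedNbhd G A w ⊎ w ∈ U
      cost          : ∣ A ∣ + ∣ U ∣ + slack ≤ ∣ R ∣ * (Δ + 2)
      slack-large   : RootBound Δ ∣ R ∣ slack

  greedyCover-⊥ : GreedyCover ⊥
  greedyCover-⊥ = record
    { A             = ⊥
    ; U             = ⊥
    ; slack         = 0
    ; A⊆R           = ⊆-refl
    ; A-independent = λ _ _ u∈⊥ _ → ⊥-elim (∉⊥ u∈⊥)
    ; covers        = λ where
        (inj₁ w∈⊥)           → ⊥-elim (∉⊥ w∈⊥)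
        (inj₂ (_ , v∈⊥ , _)) → ⊥-elim (∉⊥ v∈⊥)
    ; cost          = subst (λ z → z + z + 0 ≤ z * (Δ + 2)) (sym (∣⊥∣≡0 n)) z≤n
    ; slack-large   = subst (λ z → RootBound Δ z 0) (sym (∣⊥∣≡0 n)) z≤n
    }

  module GreedyStep {R : Subset n} {v : Fin n} (v∈R : v ∈ R)
    (v-minimal : ∀ {u} → u ∈ R → ∣ R ∩ nbhd G v ∣ ≤ ∣ R ∩ nbhd G u ∣) where

    B : Subset n
    B = R ∩ nbhd G v

    d : ℕ
    d = ∣ B ∣

    R' : Subset n
    R' = R ─ nbhd G v - v

    U₀ : Subset n
    U₀ = unionOver B (λ b → nbhd G b ─ R)

    ∣R∣≡1+d+∣R'∣ : ∣ R ∣ ≡ suc d + ∣ R' ∣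
    ∣R∣≡1+d+∣R'∣ = begin
      ∣ R ∣                   ≡⟨ ∣p∣≡∣p∩q∣+∣p─q∣ R (nbhd G v) ⟩
      d + ∣ R ─ nbhd G v ∣    ≡⟨ cong (d +_) (x∈p⇒∣p∣≡1+∣p-x∣ (x∈p∧x∉q⇒x∈p─q v∈R v∉nbhd[v])) ⟩
      d + suc ∣ R' ∣          ≡⟨ +-suc d ∣ R' ∣ ⟩
      suc d + ∣ R' ∣          ∎
      where open ≡-Reasoning

    ∣R'∣<∣R∣ : ∣ R' ∣ < ∣ R ∣
    ∣R'∣<∣R∣ = subst (∣ R' ∣ <_) (sym ∣R∣≡1+d+∣R'∣) (s≤s (m≤n+m ∣ R' ∣ d))

    R'⊆R : R' ⊆ R
    R'⊆R = ⊆-trans (p─q⊆p (R ─ nbhd G v) ⁅ v ⁆) (p─q⊆p R (nbhd G v))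

    R'-non-adjacent : ∀ {a} → a ∈ R' → adj G v a ≡ false
    R'-non-adjacent a∈R' = ∉-nbhd⁻ (x∈p─q⇒x∉q (p─q⊆p (R ─ nbhd G v) ⁅ v ⁆ a∈R'))

    d≤Δ : d ≤ Δ
    d≤Δ = ≤-trans (∣p∩q∣≤∣q∣ R (nbhd G v)) (degree≤maxDegree v)

    ∣nbhd∖R∣≤Δ∸d : ∀ {b} → b ∈ R → ∣ nbhd G b ─ R ∣ ≤ Δ ∸ d
    ∣nbhd∖R∣≤Δ∸d {b} b∈R = m+n≤o⇒m≤o∸n ∣ nbhd G b ─ R ∣ (begin
      ∣ nbhd G b ─ R ∣ + d                  ≤⟨ +-monoʳ-≤ ∣ nbhd G b ─ R ∣ d≤∣N[b]∩R∣ ⟩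
      ∣ nbhd G b ─ R ∣ + ∣ nbhd G b ∩ R ∣   ≡⟨ +-comm ∣ nbhd G b ─ R ∣ ∣ nbhd G b ∩ R ∣ ⟩
      ∣ nbhd G b ∩ R ∣ + ∣ nbhd G b ─ R ∣   ≡⟨ sym (∣p∣≡∣p∩q∣+∣p─q∣ (nbhd G b) R) ⟩
      degree G b                            ≤⟨ degree≤maxDegree b ⟩
      Δ                                     ∎)
      where
      open ≤-Reasoning
      d≤∣N[b]∩R∣ : d ≤ ∣ nbhd G b ∩ R ∣
      d≤∣N[b]∩R∣ = subst (d ≤_) (cong ∣_∣ (∩-comm R (nbhd G b))) (v-minimal b∈R)

    ∣U₀∣≤d*[Δ∸d] : ∣ U₀ ∣ ≤ d * (Δ ∸ d)
    ∣U₀∣≤d*[Δ∸d] = ∣unionOver∣≤∣B∣*c B _ (∣nbhd∖R∣≤Δ∸d ∘ p∩q⊆p R (nbhd G v))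

    member-split : ∀ {w} → w ∈ R → w ∈ R' ⊎ InClosedNbhd G ⁅ v ⁆ w
    member-split {w} w∈R with w ≟ᶠ v | w ∈? nbhd G v
    ... | yes refl | _         = inj₂ (inj₁ (x∈⁅x⁆ v))
    ... | no _     | yes w∈N   = inj₂ (inj₂ (v , x∈⁅x⁆ v , ∈-nbhd⁻ w∈N))
    ... | no w≢v   | no w∉N    = inj₁ (x∈p∧x≢y⇒x∈p-y (x∈p∧x∉q⇒x∈p─q w∈R w∉N) w≢v)

    closedNbhd-split : ∀ {w} → InClosedNbhd G R w →
                       InClosedNbhd G R' w ⊎ InClosedNbhd G ⁅ v ⁆ w ⊎ w ∈ U₀
    closedNbhd-split (inj₁ w∈R) = Sum.map inj₁ inj₁ (member-split w∈R)
    closedNbhd-split {w} (inj₂ (r , r∈R , rw)) with member-split r∈R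
    ... | inj₁ r∈R'                    = inj₁ (inj₂ (r , r∈R' , rw))
    ... | inj₂ (inj₁ r∈⁅v⁆)            = inj₂ (inj₁ (inj₂ (r , r∈⁅v⁆ , rw)))
    ... | inj₂ (inj₂ (v' , v'∈⁅v⁆ , v'r)) with x∈⁅y⁆⇒x≡y v v'∈⁅v⁆ | w ∈? R
    ...   | refl | yes w∈R = Sum.map inj₁ inj₁ (member-split w∈R)
    ...   | refl | no w∉R  =
      inj₂ (inj₂ (∈-unionOver⁺ _ (x∈p∩q⁺ (r∈R , ∈-nbhd⁺ v'r)) (x∈p∧x∉q⇒x∈p─q (∈-nbhd⁺ rw) w∉R)))

    extend : GreedyCover R' → GreedyCover R
    extend rest = record
      { A             = A' ∪ ⁅ v ⁆
      ; U             = U₀ ∪ U'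
      ; slack         = group-slack + slack'
      ; A⊆R           = A⊆R
      ; A-independent = independent-∪⁅⁆ A'-independent
                          (λ a∈A' → trans (Graph.sym G _ v) (R'-non-adjacent (A'⊆R' a∈A')))
      ; covers        = covers
      ; cost          = cost
      ; slack-large   = subst (λ m → RootBound Δ m (group-slack + slack')) (sym ∣R∣≡1+d+∣R'∣)
                          (RootBound-+ {Δ} {suc d} {∣ R' ∣} {group-slack} {slack'}
                                       (RootBound-square Δ (suc d)) slack-large')
      }
      where
      open GreedyCover rest renaming
        (A to A'; U to U'; slack to slack'; A⊆R to A'⊆R'; A-independent to A'-independent;
         covers to covers'; cost to cost'; slack-large to slack-large')

      group-slack : ℕ
      group-slack = suc d * suc d + Δ

      A⊆R : A' ∪ ⁅ v ⁆ ⊆ R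
      A⊆R a∈A with x∈p∪q⁻ A' ⁅ v ⁆ a∈A
      ... | inj₁ a∈A'  = R'⊆R (A'⊆R' a∈A')
      ... | inj₂ a∈⁅v⁆ rewrite x∈⁅y⁆⇒x≡y v a∈⁅v⁆ = v∈R

      covers : ∀ {w} → InClosedNbhd G R w → InClosedNbhd G (A' ∪ ⁅ v ⁆) w ⊎ w ∈ U₀ ∪ U'
      covers w∈N[R] with closedNbhd-split w∈N[R]
      ... | inj₁ w∈N[R'] = Sum.map (closedNbhd-mono (p⊆p∪q ⁅ v ⁆)) (q⊆p∪q U₀ U') (covers' w∈N[R'])
      ... | inj₂ (inj₁ w∈N[v]) = inj₁ (closedNbhd-mono (q⊆p∪q A' ⁅ v ⁆) w∈N[v])
      ... | inj₂ (inj₂ w∈U₀)   = inj₂ (p⊆p∪q U' w∈U₀)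

      regroup : ∀ a s u y z → suc a + (s + u) + (y + z) ≡ 1 + s + y + (a + u + z)
      regroup = solve-∀

      cost : ∣ A' ∪ ⁅ v ⁆ ∣ + ∣ U₀ ∪ U' ∣ + (group-slack + slack') ≤ ∣ R ∣ * (Δ + 2)
      cost = begin
        ∣ A' ∪ ⁅ v ⁆ ∣ + ∣ U₀ ∪ U' ∣ + (group-slack + slack')
          ≤⟨ +-monoˡ-≤ (group-slack + slack')
               (+-mono-≤ (∣p∪⁅x⁆∣≤1+∣p∣ A' v)
                         (≤-trans (∣p∪q∣≤∣p∣+∣q∣ U₀ U') (+-monoˡ-≤ ∣ U' ∣ ∣U₀∣≤d*[Δ∸d]))) ⟩
        suc ∣ A' ∣ + (d * (Δ ∸ d) + ∣ U' ∣) + (group-slack + slack')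
          ≡⟨ regroup (∣ A' ∣) (d * (Δ ∸ d)) (∣ U' ∣) group-slack slack' ⟩
        1 + d * (Δ ∸ d) + group-slack + (∣ A' ∣ + ∣ U' ∣ + slack')
          ≤⟨ +-mono-≤ (≤-reflexive (group-cost d≤Δ)) cost' ⟩
        suc d * (Δ + 2) + ∣ R' ∣ * (Δ + 2)
          ≡⟨ sym (*-distribʳ-+ (Δ + 2) (suc d) ∣ R' ∣) ⟩
        (suc d + ∣ R' ∣) * (Δ + 2)
          ≡⟨ cong (_* (Δ + 2)) (sym ∣R∣≡1+d+∣R'∣) ⟩
        ∣ R ∣ * (Δ + 2)
          ∎
        where open ≤-Reasoning

  greedyCover : (R : Subset n) → Acc _<_ ∣ R ∣ → GreedyCover R
  greedyCover R (acc smaller) with nonempty? R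
  ... | no R-empty = subst GreedyCover (sym (Empty-unique R-empty)) greedyCover-⊥
  ... | yes R-nonempty with minimiser (λ u → ∣ R ∩ nbhd G u ∣) R R-nonempty
  ... | v , v∈R , v-minimal =
    extend (greedyCover R' (smaller ∣R'∣<∣R∣))
    where open GreedyStep v∈R v-minimal

  independentIsolatingSet : ∀ {k S} → IsKkIsolating G k S →
    ∃₂ λ T X → IsIndepKkIsolating G k T × ∣ T ∣ + X ≤ ∣ S ∣ * (Δ + 2) × RootBound Δ ∣ S ∣ X
  independentIsolatingSet {k} {S} S-isolating =
    T , slack , (isolating-mono N[S]⊆N[T] S-isolating , T-independent) ,
    ≤-trans (+-monoˡ-≤ slack ∣T∣≤∣A∣+∣U∣) cost , slack-large
    where
    open GreedyCover (greedyCover S (<-wellFounded ∣ S ∣))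
    open IndependentDominator (independentDominator A-independent U (<-wellFounded ∣ U ∣))

    N[S]⊆N[T] : ∀ {w} → InClosedNbhd G S w → InClosedNbhd G T w
    N[S]⊆N[T] w∈N[S] = Sum.[ closedNbhd-mono A⊆T , dominates-U ] (covers w∈N[S])

corollary1 : ∀ (n : ℕ) (G : Graph n) (k : ℕ) → 1 ≤ k →
    ∀ (i i' : ℕ) → IsIota G k i → IsIotaIndep G k i' → 0 < i →
    let Δ = maxDegree G in
    (i' ≤ i * (Δ + 2)) × (4 * (i * i) * Δ ≤ (i * (Δ + 2) ∸ i') ^ 2)
corollary1 n G k _ .(∣ S ∣) i' ((S , S-isolating , refl) , _) (_ , i'-minimal) _
  with independentIsolatingSet G S-isolating
... | T , X , T-indep-isolating , ∣T∣+X≤M , X-large =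
  m+n≤o⇒m≤o i' i'+X≤M ,
  subst (4 * (∣ S ∣ * ∣ S ∣) * Δ ≤_) (cong ((M ∸ i') *_) (sym (*-identityʳ (M ∸ i'))))
        (RootBound-mono {Δ} {∣ S ∣} X≤M∸i' X-large)
  where
  Δ : ℕ
  Δ = maxDegree G

  M : ℕ
  M = ∣ S ∣ * (Δ + 2)

  i'+X≤M : i' + X ≤ M
  i'+X≤M = ≤-trans (+-monoˡ-≤ X (i'-minimal T T-indep-isolating)) ∣T∣+X≤M

  X≤M∸i' : X ≤ M ∸ i'
  X≤M∸i' = m+n≤o⇒m≤o∸n X (subst (_≤ M) (+-comm i' X) i'+X≤M)
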